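{- Let $N\subset\mathbb R^2$ be a lattice with dual lattice $M$, $\ell>1$ an integer, and $Q$ an $\ell$-reflexive polygon w.r.t. $N$ with vertices $\mathbf n_1,\dots,\mathbf n_\nu$ in anticlockwise order; let $\mathbf m_i,q_i,q_i^\ast,p_i,p_i^\ast,r_i,r_i^\ast$ be as in the context (indices mod $\nu$). Then for each $i\in\{1,\dots,\nu\}$, $$q_i^\ast=\ell^2\Big(\frac{q_{i-1}-\widehat p_{i-1}+1}{q_{i-1}}+\frac{q_i-p_i+1}{q_i}-r_i\Big),\qquad q_i=\ell^2\Big(\frac{q_i^\ast-\widehat{p_i^\ast}+1}{q_i^\ast}+\frac{q_{i+1}^\ast-p_{i+1}^\ast+1}{q_{i+1}^\ast}-r_i^\ast\Big).$$
   Context: A lattice in $\mathbb R^2$ is a discrete additive subgroup spanning $\mathbb R^2$; $M=\{\mathbf x:\langle\mathbf x,\mathbf n\rangle\in\mathbb Z\ \forall\mathbf n\in N\}$; $\det(N)$ the absolute determinant of a basis, $\det(M)=1/\det(N)$. An $\ell$-reflexive polygon w.r.t. $N$ is a convex polygon with vertices in $N$, $\mathbf 0$ in its interior, primitive vertices, every edge $F$ on a line $\{\mathbf y:\langle\boldsymbol\eta_F,\mathbf y\rangle=-\ell\}$ with $\boldsymbol\eta_F\in M$ primitive. $F_i=\mathrm{conv}\{\mathbf n_i,\mathbf n_{i+1}\}$, $\mathbf m_i=\boldsymbol\eta_{F_i}$ (vertices, anticlockwise, of $Q^\ast=\ell Q^\circ$), $q_i=\det(\mathbf n_i,\mathbf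 n_{i+1})/\det(N)$, $q_i^\ast=\det(\mathbf m_{i-1},\mathbf m_i)/\det(M)$. For a cone with primitive generators $\mathbf a_1,\mathbf a_2$ of a lattice $L$ (in this order) and $q=|\det(\mathbf a_1,\mathbf a_2)|/\det(L)$, its type $p$ is the unique integer $0\le p<q$ with $\mathbf a_2=p\mathbf a_1+q\mathbf a_1'$, $\{\mathbf a_1,\mathbf a_1'\}$ a basis of $L$. $p_i$ is the type of $\mathbb R_{\ge0}\mathbf n_i+\mathbb R_{\ge0}\mathbf n_{i+1}$ (order $\mathbf n_i,\mathbf n_{i+1}$), $p_i^\ast$ that of $\mathbb R_{\ge0}\mathbf m_{i-1}+\mathbb R_{\ge0}\mathbf m_i$ (order $\mathbf m_{i-1},\mathbf m_i$). For $0\le p<q$, $\gcd(p,q)=1$, the socius $\widehat p$ is the integer $0\le\widehat p<q$ with $p\widehat p\equiv1\pmod q$. Since $\ell>1$ all $q_i,q_i^\ast>1$. The integers $r_i$, $r_i^\ast$ are defined by $r_i\mathbf n_i=\tfrac1{q_{i-1}}\big(\mathbf n_{i-1}+(q_{i-1}-\widehat p_{i-1})\mathbf n_i\big)+\tfrac1{q_i}\big((q_i-p_i)\mathbf n_i+\mathbf n_{i+1}\big)$ and $r_i^\ast\mathbf m_i=\tfrac1{q_i^\ast}\big(\mathbf m_{i-1}+(q_i^\ast-\widehat{p_i^\ast})\mathbf m_i\big)+\tfrac1{q_{i+1}^\ast}\big((q_{i+1}^\ast-p_{i+1}^\ast)\mathbf m_i+\mathbf m_{i+1}\big)$ (the two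 summands on each right-hand side are lattice points, and $-r_i$, $-r_i^\ast$ are the self-intersection numbers of the strict transforms of the corresponding torus-invariant curves in the minimal resolutions). -}

module Defs where

open import Data.Nat as ℕ using (ℕ; suc)
open import Data.Nat.DivMod using (_mod_)
open import Data.Nat.GCD using (gcd)
open import Data.Fin using (Fin; toℕ)
open import Data.Integer using (ℤ; +_; -_; _+_; _-_; _*_; _<_; _≤_; ∣_∣; 0ℤ; 1ℤ; -1ℤ)
open import Data.Integer.Divisibility using (_∣_)
open import Data.Product using (_×_; _,_; Σ)
open import Data.Sum using (_⊎_)
open import Relation.Binary.PropositionalEquality using (_≡_; _≢_)

-- The lattice N is identified with ℤ² (via a basis), so det(N) = 1, and
-- M = ℤ² with the standard pairing, det(M) = 1.
V2 : Set
V2 = ℤ × ℤ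

det : V2 → V2 → ℤ
det (a , b) (c , d) = a * d - b * c

dot : V2 → V2 → ℤ
dot (a , b) (c , d) = a * c + b * d

infixl 7 _·_
infixl 6 _⊕_

_·_ : ℤ → V2 → V2
k · (a , b) = (k * a , k * b)

_⊕_ : V2 → V2 → V2
(a , b) ⊕ (c , d) = (a + c , b + d)

Primitive : V2 → Set
Primitive (a , b) = gcd ∣ a ∣ ∣ b ∣ ≡ 1

nxt : {k : ℕ} → Fin (suc k) → Fin (suc k)
nxt {k} i = suc (toℕ i) mod suc k

prv : {k : ℕ} → Fin (suc k) → Fin (suc k)
prv {k} i = (toℕ i ℕ.+ k) mod suc k

-- Q = conv{n_0..n_k} is ℓ-reflexive w.r.t. ℤ², vertices n_i listed anticlockwise,
-- and m i is the primitive η_{F_i} ∈ M with F_i = conv{n_i, n_{i+1}} ⊆ {⟨η,y⟩ = -ℓ}.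
record LReflexive (ℓ : ℕ) (k : ℕ) (n m : Fin (suc k) → V2) : Set where
  field
    atLeast3     : 3 ℕ.≤ suc k
    primVertex   : ∀ i → Primitive (n i)
    primNormal   : ∀ i → Primitive (m i)
    edgeStart    : ∀ i → dot (m i) (n i) ≡ - (+ ℓ)
    edgeEnd      : ∀ i → dot (m i) (n (nxt i)) ≡ - (+ ℓ)
    strictSide   : ∀ i j → j ≢ i → j ≢ nxt i → - (+ ℓ) < dot (m i) (n j)
    anticlockwise : ∀ i → 0ℤ < det (n i) (n (nxt i))

IsType : V2 → V2 → ℤ → Set
IsType a₁ a₂ p =
  0ℤ ≤ p × p < + ∣ det a₁ a₂ ∣ ×
  Σ V2 (λ a₁' → (det a₁ a₁' ≡ 1ℤ ⊎ det a₁ a₁' ≡ -1ℤ) × a₂ ≡ p · a₁ ⊕ (+ ∣ det a₁ a₂ ∣) · a₁')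

IsSocius : ℤ → ℤ → ℤ → Set
IsSocius q p p̂ = 0ℤ ≤ p̂ × p̂ < q × q ∣ (p * p̂ - 1ℤ)

qN : {k : ℕ} → (Fin (suc k) → V2) → Fin (suc k) → ℤ
qN n i = det (n i) (n (nxt i))

qM : {k : ℕ} → (Fin (suc k) → V2) → Fin (suc k) → ℤ
qM m i = det (m (prv i)) (m i)

-- The dual vertices m_{i-1}, m_i both take the value -ℓ on the vertex n_i, so the
-- Binet–Cauchy identity det(u,v)·det(x,y) = ⟨u,x⟩⟨v,y⟩ - ⟨u,y⟩⟨v,x⟩ gives
-- q*_i · q_i = ℓ² + ℓ⟨m_{i-1}, n_{i+1}⟩. Pairing the relation defining r_i with
-- m_{i-1} expresses q_{i-1}⟨m_{i-1}, n_{i+1}⟩ through ℓ, the q's, p's and r_i,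
-- which yields the first formula. The second one is the same argument for the
-- dual polygon, whose dual vertices are again the n_i. Only the relations defining
-- r_i and r*_i enter; the type and socius conditions just make them integral.
module Submission where

open import Data.Nat using (ℕ; suc; NonZero)
import Data.Nat as ℕ
open import Data.Nat.DivMod using (_%_; _mod_; %-distribˡ-+; m%n%n≡m%n; [m+n]%n≡m%n; m<n⇒m%n≡m; m%n<n)
open import Data.Nat.Properties using (+-assoc; +-comm)
open import Data.Fin using (Fin; toℕ)
open import Data.Fin.Properties using (toℕ-injective; toℕ-fromℕ<; toℕ<n)
open import Data.Integer using (ℤ; +_; -_; _+_; _-_; _*_; 0ℤ; 1ℤ)
open import Data.Integer.Properties using (*-comm; *-assoc; *-zeroʳ; +-inverseʳ; +-identityʳ)
open import Data.Integer.Tactic.RingSolver using (solve-∀)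
open import Data.Product using (_×_; _,_)
open import Relation.Binary.PropositionalEquality
  using (_≡_; refl; sym; trans; cong; cong₂; subst; module ≡-Reasoning)

open import Defs

open ≡-Reasoning

toℕ-mod : ∀ m d .{{_ : NonZero d}} → toℕ (m mod d) ≡ m % d
toℕ-mod m d = toℕ-fromℕ< (m%n<n m d)

[m%d+n]%d≡[m+n]%d : ∀ m n d .{{_ : NonZero d}} → (m % d ℕ.+ n) % d ≡ (m ℕ.+ n) % d
[m%d+n]%d≡[m+n]%d m n d = begin
  (m % d ℕ.+ n) % d          ≡⟨ %-distribˡ-+ (m % d) n d ⟩
  (m % d % d ℕ.+ n % d) % d  ≡⟨ cong (λ t → (t ℕ.+ n % d) % d) (m%n%n≡m%n m d) ⟩
  (m % d ℕ.+ n % d) % d      ≡⟨ %-distribˡ-+ m n d ⟨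
  (m ℕ.+ n) % d              ∎

[[m+a]%d+b]%d≡m : ∀ m a b d .{{_ : NonZero d}} → m ℕ.< d → a ℕ.+ b ≡ d →
                  ((m ℕ.+ a) % d ℕ.+ b) % d ≡ m
[[m+a]%d+b]%d≡m m a b d m<d a+b≡d = begin
  ((m ℕ.+ a) % d ℕ.+ b) % d  ≡⟨ [m%d+n]%d≡[m+n]%d (m ℕ.+ a) b d ⟩
  (m ℕ.+ a ℕ.+ b) % d        ≡⟨ cong (_% d) (trans (+-assoc m a b) (cong (m ℕ.+_) a+b≡d)) ⟩
  (m ℕ.+ d) % d              ≡⟨ [m+n]%n≡m%n m d ⟩
  m % d                      ≡⟨ m<n⇒m%n≡m m<d ⟩
  m                          ∎

nxt-prv : ∀ {k} (i : Fin (suc k)) → nxt (prv i) ≡ i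
nxt-prv {k} i = toℕ-injective (begin
  toℕ (nxt (prv i))                     ≡⟨ toℕ-mod (suc (toℕ (prv i))) (suc k) ⟩
  (1 ℕ.+ toℕ (prv i)) % suc k           ≡⟨ cong (_% suc k) (+-comm 1 (toℕ (prv i))) ⟩
  (toℕ (prv i) ℕ.+ 1) % suc k           ≡⟨ cong (λ t → (t ℕ.+ 1) % suc k) (toℕ-mod (toℕ i ℕ.+ k) (suc k)) ⟩
  ((toℕ i ℕ.+ k) % suc k ℕ.+ 1) % suc k ≡⟨ [[m+a]%d+b]%d≡m (toℕ i) k 1 (suc k) (toℕ<n i) (+-comm k 1) ⟩
  toℕ i                                 ∎)

prv-nxt : ∀ {k} (i : Fin (suc k)) → prv (nxt i) ≡ i
prv-nxt {k} i = toℕ-injective (begin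
  toℕ (prv (nxt i))                     ≡⟨ toℕ-mod (toℕ (nxt i) ℕ.+ k) (suc k) ⟩
  (toℕ (nxt i) ℕ.+ k) % suc k            ≡⟨ cong (λ t → (t ℕ.+ k) % suc k) (toℕ-mod (suc (toℕ i)) (suc k)) ⟩
  ((1 ℕ.+ toℕ i) % suc k ℕ.+ k) % suc k  ≡⟨ cong (λ t → (t % suc k ℕ.+ k) % suc k) (+-comm 1 (toℕ i)) ⟩
  ((toℕ i ℕ.+ 1) % suc k ℕ.+ k) % suc k  ≡⟨ [[m+a]%d+b]%d≡m (toℕ i) 1 k (suc k) (toℕ<n i) refl ⟩
  toℕ i                                  ∎)

dot-comm : ∀ x y → dot x y ≡ dot y x
dot-comm (a , b) (c , d) = cong₂ _+_ (*-comm a c) (*-comm b d)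

dot-distribˡ-⊕ : ∀ u x y → dot u (x ⊕ y) ≡ dot u x + dot u y
dot-distribˡ-⊕ (a , b) (c , d) (e , f) = ring a b c d e f
  where
  ring : ∀ a b c d e f → a * (c + e) + b * (d + f) ≡ (a * c + b * d) + (a * e + b * f)
  ring = solve-∀

dot-·ʳ : ∀ u k x → dot u (k · x) ≡ k * dot u x
dot-·ʳ (a , b) k (c , d) = ring a b k c d
  where
  ring : ∀ a b k c d → a * (k * c) + b * (k * d) ≡ k * (a * c + b * d)
  ring = solve-∀

det-*-det : ∀ u v x y → det u v * det x y ≡ dot u x * dot v y - dot u y * dot v x
det-*-det (a , b) (c , d) (e , f) (g , h) = ring a b c d e f g h
  where
  ring : ∀ a b c d e f g h →
         (a * d - b * c) * (e * h - f * g)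
           ≡ (a * e + b * f) * (c * g + d * h) - (a * g + b * h) * (c * e + d * f)
  ring = solve-∀

vertex-identity : ∀ (L q₁ q₂ p p̂ r D x : ℤ) →
  D * q₂ ≡ L * L + L * x →
  q₁ * q₂ * r * - L ≡ q₂ * (- L + (q₁ - p̂) * - L) + q₁ * ((q₂ - p) * - L + x) →
  D * (q₁ * q₂) ≡ L * L * ((q₁ - p̂ + 1ℤ) * q₂ + (q₂ - p + 1ℤ) * q₁ - r * (q₁ * q₂))
vertex-identity L q₁ q₂ p p̂ r D x det-q₂ paired = begin
  D * (q₁ * q₂)                 ≡⟨ *-comm D (q₁ * q₂) ⟩
  q₁ * q₂ * D                   ≡⟨ *-assoc q₁ q₂ D ⟩
  q₁ * (q₂ * D)                 ≡⟨ cong (q₁ *_) (*-comm q₂ D) ⟩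
  q₁ * (D * q₂)                 ≡⟨ cong (q₁ *_) det-q₂ ⟩
  q₁ * (L * L + L * x)          ≡⟨ expand L q₁ q₂ p p̂ r x ⟩
  L * L * E + L * (Rhs - Lhs)   ≡⟨ cong (λ t → L * L * E + L * (t - Lhs)) (sym paired) ⟩
  L * L * E + L * (Lhs - Lhs)   ≡⟨ cong (λ t → L * L * E + L * t) (+-inverseʳ Lhs) ⟩
  L * L * E + L * 0ℤ            ≡⟨ cong (λ t → L * L * E + t) (*-zeroʳ L) ⟩
  L * L * E + 0ℤ                ≡⟨ +-identityʳ (L * L * E) ⟩
  L * L * E                     ∎
  where
  E   = (q₁ - p̂ + 1ℤ) * q₂ + (q₂ - p + 1ℤ) * q₁ - r * (q₁ * q₂)
  Lhs = q₁ * q₂ * r * - L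
  Rhs = q₂ * (- L + (q₁ - p̂) * - L) + q₁ * ((q₂ - p) * - L + x)
  expand : ∀ L q₁ q₂ p p̂ r x →
    q₁ * (L * L + L * x)
      ≡ L * L * ((q₁ - p̂ + 1ℤ) * q₂ + (q₂ - p + 1ℤ) * q₁ - r * (q₁ * q₂))
        + L * (q₂ * (- L + (q₁ - p̂) * - L) + q₁ * ((q₂ - p) * - L + x) - q₁ * q₂ * r * - L)
  expand = solve-∀

det-normals-at-vertex : ∀ (L q₁ q₂ p p̂ r : ℤ) (a b c u v : V2) →
  det b c ≡ q₂ →
  dot u a ≡ - L → dot u b ≡ - L → dot v b ≡ - L → dot v c ≡ - L →
  (q₁ * q₂ * r) · b ≡ q₂ · (a ⊕ (q₁ - p̂) · b) ⊕ q₁ · ((q₂ - p) · b ⊕ c) →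
  det u v * (q₁ * q₂) ≡ L * L * ((q₁ - p̂ + 1ℤ) * q₂ + (q₂ - p + 1ℤ) * q₁ - r * (q₁ * q₂))
det-normals-at-vertex L q₁ q₂ p p̂ r a b c u v det-bc ua ub vb vc relation =
  vertex-identity L q₁ q₂ p p̂ r (det u v) (dot u c) binet paired
  where
  binet : det u v * q₂ ≡ L * L + L * dot u c
  binet = begin
    det u v * q₂                           ≡⟨ cong (det u v *_) (sym det-bc) ⟩
    det u v * det b c                      ≡⟨ det-*-det u v b c ⟩
    dot u b * dot v c - dot u c * dot v b  ≡⟨ cong₂ (λ s t → s * t - dot u c * dot v b) ub vc ⟩
    - L * - L - dot u c * dot v b          ≡⟨ cong (λ t → - L * - L - dot u c * t) vb ⟩
    - L * - L - dot u c * - L              ≡⟨ ring L (dot u c) ⟩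
    L * L + L * dot u c                    ∎
    where
    ring : ∀ L x → - L * - L - x * - L ≡ L * L + L * x
    ring = solve-∀

  paired : q₁ * q₂ * r * - L ≡ q₂ * (- L + (q₁ - p̂) * - L) + q₁ * ((q₂ - p) * - L + dot u c)
  paired = begin
    q₁ * q₂ * r * - L
      ≡⟨ cong (q₁ * q₂ * r *_) (sym ub) ⟩
    q₁ * q₂ * r * dot u b
      ≡⟨ dot-·ʳ u (q₁ * q₂ * r) b ⟨
    dot u ((q₁ * q₂ * r) · b)
      ≡⟨ cong (dot u) relation ⟩
    dot u (q₂ · (a ⊕ (q₁ - p̂) · b) ⊕ q₁ · ((q₂ - p) · b ⊕ c))
      ≡⟨ dot-distribˡ-⊕ u _ _ ⟩
    dot u (q₂ · (a ⊕ (q₁ - p̂) · b)) + dot u (q₁ · ((q₂ - p) · b ⊕ c))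
      ≡⟨ cong₂ _+_ (dot-·ʳ u q₂ _) (dot-·ʳ u q₁ _) ⟩
    q₂ * dot u (a ⊕ (q₁ - p̂) · b) + q₁ * dot u ((q₂ - p) · b ⊕ c)
      ≡⟨ cong₂ (λ s t → q₂ * s + q₁ * t) (dot-distribˡ-⊕ u a ((q₁ - p̂) · b)) (dot-distribˡ-⊕ u ((q₂ - p) · b) c) ⟩
    q₂ * (dot u a + dot u ((q₁ - p̂) · b)) + q₁ * (dot u ((q₂ - p) · b) + dot u c)
      ≡⟨ cong₂ (λ s t → q₂ * (dot u a + s) + q₁ * (t + dot u c)) (dot-·ʳ u (q₁ - p̂) b) (dot-·ʳ u (q₂ - p) b) ⟩
    q₂ * (dot u a + (q₁ - p̂) * dot u b) + q₁ * ((q₂ - p) * dot u b + dot u c)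
      ≡⟨ cong₂ (λ s t → q₂ * (s + (q₁ - p̂) * t) + q₁ * ((q₂ - p) * t + dot u c)) ua ub ⟩
    q₂ * (- L + (q₁ - p̂) * - L) + q₁ * ((q₂ - p) * - L + dot u c)
      ∎

proposition7p14 : (ℓ : ℕ) → 1 Data.Nat.< ℓ → (k : ℕ) → (n m : Fin (suc k) → V2) →
      LReflexive ℓ k n m →
      (p p* p̂ p̂* r r* : Fin (suc k) → ℤ) →
      (∀ i → IsType (n i) (n (nxt i)) (p i)) →
      (∀ i → IsType (m (prv i)) (m i) (p* i)) →
      (∀ i → IsSocius (qN n i) (p i) (p̂ i)) →
      (∀ i → IsSocius (qM m i) (p* i) (p̂* i)) →
      (∀ i → (qN n (prv i) * qN n i * r i) · n i
             ≡ qN n i · (n (prv i) ⊕ (qN n (prv i) - p̂ (prv i)) · n i)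
               ⊕ qN n (prv i) · ((qN n i - p i) · n i ⊕ n (nxt i))) →
      (∀ i → (qM m i * qM m (nxt i) * r* i) · m i
             ≡ qM m (nxt i) · (m (prv i) ⊕ (qM m i - p̂* i) · m i)
               ⊕ qM m i · ((qM m (nxt i) - p* (nxt i)) · m i ⊕ m (nxt i))) →
      ∀ i →
        (qM m i * (qN n (prv i) * qN n i)
          ≡ (+ ℓ * + ℓ) * ((qN n (prv i) - p̂ (prv i) + 1ℤ) * qN n i
                           + (qN n i - p i + 1ℤ) * qN n (prv i)
                           - r i * (qN n (prv i) * qN n i)))
        ×
        (qN n i * (qM m i * qM m (nxt i))
          ≡ (+ ℓ * + ℓ) * ((qM m i - p̂* i + 1ℤ) * qM m (nxt i)
                           + (qM m (nxt i) - p* (nxt i) + 1ℤ) * qM m i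
                           - r* i * (qM m i * qM m (nxt i))))
proposition7p14 ℓ _ k n m reflexive p p* p̂ p̂* r r* _ _ _ _ r-relation r*-relation i =
  det-normals-at-vertex (+ ℓ) (qN n (prv i)) (qN n i) (p i) (p̂ (prv i)) (r i)
    (n (prv i)) (n i) (n (nxt i)) (m (prv i)) (m i)
    refl (edgeStart (prv i)) edgeEnd-prv (edgeStart i) (edgeEnd i) (r-relation i)
  ,
  det-normals-at-vertex (+ ℓ) (qM m i) (qM m (nxt i)) (p* (nxt i)) (p̂* i) (r* i)
    (m (prv i)) (m i) (m (nxt i)) (n i) (n (nxt i))
    (cong (λ j → det (m j) (m (nxt i))) (sym (prv-nxt i)))
    (trans (dot-comm (n i) (m (prv i))) edgeEnd-prv)
    (trans (dot-comm (n i) (m i)) (edgeStart i))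
    (trans (dot-comm (n (nxt i)) (m i)) (edgeEnd i))
    (trans (dot-comm (n (nxt i)) (m (nxt i))) (edgeStart (nxt i)))
    (r*-relation i)
  where
  open LReflexive reflexive
  edgeEnd-prv : dot (m (prv i)) (n i) ≡ - (+ ℓ)
  edgeEnd-prv = subst (λ j → dot (m (prv i)) (n j) ≡ - (+ ℓ)) (nxt-prv i) (edgeEnd (prv i))
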